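{- Let $L=(l,r)$ be a balanced algebraic law over a signature of binary operation symbols, and let $x$ be a variable occurring in $l$ exactly at the addresses $\beta_1,\dots,\beta_p$ and in $r$ exactly at the addresses $\gamma_1,\dots,\gamma_q$. Then for every balanced law $L'$ and all addresses $\alpha,\delta$, $$O^{L',+}_{\alpha\beta_1\delta}\bullet\cdots\bullet O^{L',+}_{\alpha\beta_p\delta}\bullet O^{L,+}_\alpha=O^{L,+}_\alpha\bullet O^{L',+}_{\alpha\gamma_1\delta}\bullet\cdots\bullet O^{L',+}_{\alpha\gamma_q\delta}.$$
   Context: Terms are built from an infinite set of variables using binary operation symbols; addresses are words over $\{0,1\}$ ($0$ = left, $1$ = right), $t/\alpha$ is the subterm at $\alpha$. A law $(l,r)$ is balanced if the same variables occur in $l$ and $r$. For a law $L=(l,r)$ and address $\alpha$, $O^{L,+}_\alpha$ is the partial operator mapping $t$ to the term obtained by replacing $t/\alpha=l\sigma$ (for a substitution $\sigma$) by $r\sigma$, defined exactly when $t/\alpha$ is an instance of $l$. $f\bullet g$ denotes composition "first $f$, then $g$"; equality is equality of partial maps. -}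

module Defs where

open import Data.Nat using (ℕ)
open import Data.List using (List; []; _∷_; _++_; map)
open import Data.Maybe using (Maybe; just; nothing; _>>=_)
open import Data.Product using (Σ; ∃; _×_; _,_)
open import Relation.Binary.PropositionalEquality using (_≡_)
open import Function.Bundles using (_⇔_)

-- Directions of an address: 𝟎 = left, 𝟏 = right.
data Bit : Set where
  𝟎 𝟏 : Bit

Address : Set
Address = List Bit

module Terms (Op : Set) where

  data Term : Set where
    var : ℕ → Term
    op  : Op → Term → Term → Term

  _/_ : Term → Address → Maybe Term
  t          / []      = just t
  var _      / (_ ∷ _) = nothing
  op f t₀ t₁ / (𝟎 ∷ α) = t₀ / α
  op f t₀ t₁ / (𝟏 ∷ α) = t₁ / α

  replace : Term → Address → Term → Maybe Term
  replace t          []      s = just s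
  replace (var _)    (_ ∷ _) s = nothing
  replace (op f t₀ t₁) (𝟎 ∷ α) s = replace t₀ α s >>= λ u → just (op f u t₁)
  replace (op f t₀ t₁) (𝟏 ∷ α) s = replace t₁ α s >>= λ u → just (op f t₀ u)

  Substitution : Set
  Substitution = ℕ → Term

  _⟨_⟩ : Term → Substitution → Term
  var x ⟨ σ ⟩ = σ x
  op f t₀ t₁ ⟨ σ ⟩ = op f (t₀ ⟨ σ ⟩) (t₁ ⟨ σ ⟩)

  data Occurs (x : ℕ) : Term → Set where
    here : Occurs x (var x)
    left  : ∀ {f t₀ t₁} → Occurs x t₀ → Occurs x (op f t₀ t₁)
    right : ∀ {f t₀ t₁} → Occurs x t₁ → Occurs x (op f t₀ t₁)

  Law : Set
  Law = Term × Term

  Balanced : Law → Set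
  Balanced (l , r) = ∀ x → Occurs x l ⇔ Occurs x r

  -- partial maps Term ⇀ Term, represented by their graphs
  PartialOp : Set₁
  PartialOp = Term → Term → Set

  O⁺ : Law → Address → PartialOp
  O⁺ (l , r) α t t′ = ∃ λ (σ : Substitution) →
    (t / α ≡ just (l ⟨ σ ⟩)) × (replace t α (r ⟨ σ ⟩) ≡ just t′)

  -- f • g : first f, then g
  _•_ : PartialOp → PartialOp → PartialOp
  (f • g) t u = ∃ λ s → f t s × g s u

  idOp : PartialOp
  idOp t u = t ≡ u

  seq : List PartialOp → PartialOp
  seq []       = idOp
  seq (f ∷ fs) = f • seq fs

  _≐_ : PartialOp → PartialOp → Set
  f ≐ g = ∀ t u → f t u ⇔ g t u

{-# OPTIONS --safe #-}
module Submission where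

-- Both sides act only inside the subterm at α, so it suffices to treat α = [].
-- There, an L′-step at βᵢδ only changes the copy of σ x sitting at βᵢ; since L′
-- is balanced it is a partial injection, so all these steps rewrite σ x to the
-- same term and turn l ⟨ σ ⟩ into l ⟨ σ′ ⟩ with σ′ differing from σ only at x.
-- As l and r have the same variables, the steps at γⱼδ turn r ⟨ σ ⟩ into
-- r ⟨ σ′ ⟩, and applying L before or after these steps gives the same result.

open import Defs
open import Data.Nat as ℕ using (ℕ)
open import Data.List using (List; []; _∷_; map; _++_)
open import Data.List.Properties using (≡-dec; ∷-injectiveʳ)
open import Data.List.Relation.Unary.Unique.Propositional using (Unique)
open import Data.List.Relation.Unary.AllPairs using ([]; _∷_)
open import Data.List.Relation.Unary.All as All using ()
open import Data.List.Relation.Unary.Any using (here; there)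
open import Data.List.Membership.Propositional using (_∈_; _∉_)
open import Data.Maybe using (just; nothing; _>>=_)
open import Data.Maybe.Properties using (just-injective)
open import Data.Product using (∃; ∃₂; _×_; _,_; proj₁; proj₂)
open import Data.Empty using (⊥-elim)
open import Function using (_∘_; const)
open import Function.Bundles using (_⇔_; mk⇔; Equivalence)
open import Function.Properties.Equivalence using (⇔-isEquivalence)
open import Level using (0ℓ) renaming (suc to lsuc)
open import Relation.Binary.Core using (_⇒_)
open import Relation.Binary.Bundles using (Setoid)
open import Relation.Binary.Definitions using (DecidableEquality)
open import Relation.Binary.Structures using (IsEquivalence)
open import Relation.Binary.PropositionalEquality
  using (_≡_; _≢_; refl; sym; trans; cong; cong₂; cong-app; subst; subst₂)
open import Relation.Nullary using (¬_; yes; no)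
import Relation.Binary.Reasoning.Setoid as SetoidReasoning

_≟ᵇ_ : DecidableEquality Bit
𝟎 ≟ᵇ 𝟎 = yes refl
𝟎 ≟ᵇ 𝟏 = no λ ()
𝟏 ≟ᵇ 𝟎 = no λ ()
𝟏 ≟ᵇ 𝟏 = yes refl

_≟ₐ_ : DecidableEquality Address
_≟ₐ_ = ≡-dec _≟ᵇ_

module Update {A B : Set} (_≟_ : DecidableEquality A) where

  _[_≔_] : (A → B) → A → B → A → B
  (f [ a ≔ b ]) a′ with a′ ≟ a
  ... | yes _ = b
  ... | no  _ = f a′

  [≔]-same : ∀ f a b → (f [ a ≔ b ]) a ≡ b
  [≔]-same f a b with a ≟ a
  ... | yes _  = refl
  ... | no a≢a = ⊥-elim (a≢a refl)

  [≔]-other : ∀ f {a a′} b → a′ ≢ a → (f [ a ≔ b ]) a′ ≡ f a′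
  [≔]-other f {a} {a′} b a′≢a with a′ ≟ a
  ... | yes a′≡a = ⊥-elim (a′≢a a′≡a)
  ... | no  _    = refl

module Rewriting (Op : Set) where
  open Terms Op
  open Equivalence using (to; from)
  open Update {B = Substitution} _≟ₐ_
  open Update {B = Term} ℕ._≟_
    renaming (_[_≔_] to _[_↦_]; [≔]-same to [↦]-same; [≔]-other to [↦]-other)

  /-++ : ∀ t α β → t / (α ++ β) ≡ (t / α >>= _/ β)
  /-++ t            []      β = refl
  /-++ (var _)      (_ ∷ _) β = refl
  /-++ (op f t₀ t₁) (𝟎 ∷ α) β = /-++ t₀ α β
  /-++ (op f t₀ t₁) (𝟏 ∷ α) β = /-++ t₁ α β

  replace-++ : ∀ t α β {s} v → t / α ≡ just s →
               replace t (α ++ β) v ≡ (replace s β v >>= λ s′ → replace t α s′)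
  replace-++ t [] β v refl with replace t β v
  ... | just _  = refl
  ... | nothing = refl
  replace-++ (op f t₀ t₁) (𝟎 ∷ α) β {s} v e rewrite replace-++ t₀ α β v e with replace s β v
  ... | just _  = refl
  ... | nothing = refl
  replace-++ (op f t₀ t₁) (𝟏 ∷ α) β {s} v e rewrite replace-++ t₁ α β v e with replace s β v
  ... | just _  = refl
  ... | nothing = refl

  /-replace : ∀ t α {v u} → replace t α v ≡ just u → u / α ≡ just v
  /-replace t [] refl = refl
  /-replace (op f t₀ t₁) (𝟎 ∷ α) {v} e with replace t₀ α v in eq | e
  ... | just _ | refl = /-replace t₀ α eq
  /-replace (op f t₀ t₁) (𝟏 ∷ α) {v} e with replace t₁ α v in eq | e
  ... | just _ | refl = /-replace t₁ α eq

  replace-replace : ∀ t α {v u} w → replace t α v ≡ just u → replace u α w ≡ replace t α w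
  replace-replace t [] w refl = refl
  replace-replace (op f t₀ t₁) (𝟎 ∷ α) {v} w e with replace t₀ α v in eq | e
  ... | just _ | refl = cong (_>>= λ u → just (op f u t₁)) (replace-replace t₀ α w eq)
  replace-replace (op f t₀ t₁) (𝟏 ∷ α) {v} w e with replace t₁ α v in eq | e
  ... | just _ | refl = cong (_>>= λ u → just (op f t₀ u)) (replace-replace t₁ α w eq)

  replace-/ : ∀ t α {s} → t / α ≡ just s → replace t α s ≡ just t
  replace-/ t [] refl = refl
  replace-/ (op f t₀ t₁) (𝟎 ∷ α) e rewrite replace-/ t₀ α e = refl
  replace-/ (op f t₀ t₁) (𝟏 ∷ α) e rewrite replace-/ t₁ α e = refl

  replace-defined : ∀ t α {s} → t / α ≡ just s → ∀ v → ∃ λ u → replace t α v ≡ just u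
  replace-defined t [] e v = v , refl
  replace-defined (op f t₀ t₁) (𝟎 ∷ α) e v with replace-defined t₀ α e v
  ... | u , eq rewrite eq = op f u t₁ , refl
  replace-defined (op f t₀ t₁) (𝟏 ∷ α) e v with replace-defined t₁ α e v
  ... | u , eq rewrite eq = op f t₀ u , refl

  replace-undo : ∀ t α {s v u} → t / α ≡ just s → replace t α v ≡ just u → replace u α s ≡ just t
  replace-undo t α e r = trans (replace-replace t α _ r) (replace-/ t α e)

  Occurs⇒leaf : ∀ {z t} → Occurs z t → ∃ λ π → t / π ≡ just (var z)
  Occurs⇒leaf here = [] , refl
  Occurs⇒leaf (left o)  with Occurs⇒leaf o
  ... | π , e = 𝟎 ∷ π , e
  Occurs⇒leaf (right o) with Occurs⇒leaf o
  ... | π , e = 𝟏 ∷ π , e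

  leaf⇒Occurs : ∀ {z} t π → t / π ≡ just (var z) → Occurs z t
  leaf⇒Occurs (var _)      []      refl = here
  leaf⇒Occurs (op f t₀ t₁) (𝟎 ∷ π) e = left (leaf⇒Occurs t₀ π e)
  leaf⇒Occurs (op f t₀ t₁) (𝟏 ∷ π) e = right (leaf⇒Occurs t₁ π e)

  op-injective : ∀ {f g a b c d} → op f a b ≡ op g c d → a ≡ c × b ≡ d
  op-injective refl = refl , refl

  ⟨⟩-cong : ∀ t {σ σ′} → (∀ z → Occurs z t → σ z ≡ σ′ z) → t ⟨ σ ⟩ ≡ t ⟨ σ′ ⟩
  ⟨⟩-cong (var y)      agree = agree y here
  ⟨⟩-cong (op f t₀ t₁) agree =
    cong₂ (op f) (⟨⟩-cong t₀ (λ z → agree z ∘ left)) (⟨⟩-cong t₁ (λ z → agree z ∘ right))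

  ⟨⟩-cong⁻¹ : ∀ t {σ σ′} → t ⟨ σ ⟩ ≡ t ⟨ σ′ ⟩ → ∀ z → Occurs z t → σ z ≡ σ′ z
  ⟨⟩-cong⁻¹ (var y)      e z here      = e
  ⟨⟩-cong⁻¹ (op f t₀ t₁) e z (left o)  = ⟨⟩-cong⁻¹ t₀ (proj₁ (op-injective e)) z o
  ⟨⟩-cong⁻¹ (op f t₀ t₁) e z (right o) = ⟨⟩-cong⁻¹ t₁ (proj₂ (op-injective e)) z o

  Balanced-sym : ∀ {l r} → Balanced (l , r) → Balanced (r , l)
  Balanced-sym bal z = mk⇔ (from (bal z)) (to (bal z))

  rhs-determined : ∀ {l r σ σ′} → Balanced (l , r) →
                   l ⟨ σ ⟩ ≡ l ⟨ σ′ ⟩ → r ⟨ σ ⟩ ≡ r ⟨ σ′ ⟩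
  rhs-determined {l} {r} bal e = ⟨⟩-cong r (λ z o → ⟨⟩-cong⁻¹ l e z (from (bal z) o))

  -- A positional substitution instantiates every occurrence of a variable on
  -- its own: the occurrence at address π is instantiated by θ π.
  PSubst : Set
  PSubst = Address → Substitution

  _⟪_⟫ : Term → PSubst → Term
  var y      ⟪ θ ⟫ = θ [] y
  op f t₀ t₁ ⟪ θ ⟫ = op f (t₀ ⟪ θ ∘ (𝟎 ∷_) ⟫) (t₁ ⟪ θ ∘ (𝟏 ∷_) ⟫)

  ⟪const⟫ : ∀ t σ → t ⟪ const σ ⟫ ≡ t ⟨ σ ⟩
  ⟪const⟫ (var y)      σ = refl
  ⟪const⟫ (op f t₀ t₁) σ = cong₂ (op f) (⟪const⟫ t₀ σ) (⟪const⟫ t₁ σ)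

  ⟪⟫-cong : ∀ t {θ θ′} → (∀ π z → t / π ≡ just (var z) → θ π z ≡ θ′ π z) →
            t ⟪ θ ⟫ ≡ t ⟪ θ′ ⟫
  ⟪⟫-cong (var y)      agree = agree [] y refl
  ⟪⟫-cong (op f t₀ t₁) agree =
    cong₂ (op f) (⟪⟫-cong t₀ (agree ∘ (𝟎 ∷_))) (⟪⟫-cong t₁ (agree ∘ (𝟏 ∷_)))

  ⟪⟫-/ : ∀ t θ {π z} → t / π ≡ just (var z) → (t ⟪ θ ⟫) / π ≡ just (θ π z)
  ⟪⟫-/ (var y)      θ {[]}    refl = refl
  ⟪⟫-/ (op f t₀ t₁) θ {𝟎 ∷ π} e    = ⟪⟫-/ t₀ (θ ∘ (𝟎 ∷_)) e
  ⟪⟫-/ (op f t₀ t₁) θ {𝟏 ∷ π} e    = ⟪⟫-/ t₁ (θ ∘ (𝟏 ∷_)) e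

  ⟨⟩-/ : ∀ t σ {π z} → t / π ≡ just (var z) → (t ⟨ σ ⟩) / π ≡ just (σ z)
  ⟨⟩-/ t σ {π} {z} e =
    subst (λ u → u / π ≡ just (σ z)) (⟪const⟫ t σ) (⟪⟫-/ t (const σ) {π} e)

  replace-⟪⟫ : ∀ t {θ θ′ π z} → t / π ≡ just (var z) →
               (∀ ρ y → t / ρ ≡ just (var y) → ρ ≢ π → θ ρ y ≡ θ′ ρ y) →
               replace (t ⟪ θ ⟫) π (θ′ π z) ≡ just (t ⟪ θ′ ⟫)
  replace-⟪⟫ (var y) {π = []} refl agree = refl
  replace-⟪⟫ (op f t₀ t₁) {θ} {θ′} {𝟎 ∷ π} e agree
    rewrite replace-⟪⟫ t₀ {θ ∘ (𝟎 ∷_)} {θ′ ∘ (𝟎 ∷_)} e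
              (λ ρ y e′ ρ≢π → agree (𝟎 ∷ ρ) y e′ (ρ≢π ∘ ∷-injectiveʳ))
    = cong (λ u → just (op f _ u)) (⟪⟫-cong t₁ (λ ρ y e′ → agree (𝟏 ∷ ρ) y e′ λ ()))
  replace-⟪⟫ (op f t₀ t₁) {θ} {θ′} {𝟏 ∷ π} e agree
    rewrite replace-⟪⟫ t₁ {θ ∘ (𝟏 ∷_)} {θ′ ∘ (𝟏 ∷_)} e
              (λ ρ y e′ ρ≢π → agree (𝟏 ∷ ρ) y e′ (ρ≢π ∘ ∷-injectiveʳ))
    = cong (λ u → just (op f u _)) (⟪⟫-cong t₀ (λ ρ y e′ → agree (𝟎 ∷ ρ) y e′ λ ()))

  ≐-isEquivalence : IsEquivalence _≐_
  ≐-isEquivalence = record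
    { refl  = λ _ _ → ⇔.refl
    ; sym   = λ f≐g t u → ⇔.sym (f≐g t u)
    ; trans = λ f≐g g≐h t u → ⇔.trans (f≐g t u) (g≐h t u)
    }
    where module ⇔ = IsEquivalence ⇔-isEquivalence

  ≐-setoid : Setoid (lsuc 0ℓ) 0ℓ
  ≐-setoid = record { isEquivalence = ≐-isEquivalence }

  open IsEquivalence ≐-isEquivalence using () renaming (refl to ≐-refl)
  open SetoidReasoning ≐-setoid

  •-cong : ∀ {f f′ g g′} → f ≐ f′ → g ≐ g′ → (f • g) ≐ (f′ • g′)
  •-cong f≐f′ g≐g′ t u = mk⇔
    (λ (m , fm , gm) → m , to (f≐f′ t m) fm , to (g≐g′ m u) gm)
    (λ (m , fm , gm) → m , from (f≐f′ t m) fm , from (g≐g′ m u) gm)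

  •-assoc : ∀ {f g h} → ((f • g) • h) ≐ (f • (g • h))
  •-assoc t u = mk⇔
    (λ (n , (m , fm , gn) , hu) → m , fm , n , gn , hu)
    (λ (m , fm , n , gn , hu) → n , (m , fm , gn) , hu)

  •-identityˡ : ∀ {f} → (idOp • f) ≐ f
  •-identityˡ t u = mk⇔ (λ { (_ , refl , fu) → fu }) (λ fu → t , refl , fu)

  •-identityʳ : ∀ {f} → (f • idOp) ≐ f
  •-identityʳ t u = mk⇔ (λ { (_ , fu , refl) → fu }) (λ fu → u , fu , refl)

  seq-map-cong : ∀ {A : Set} {F G : A → PartialOp} as → (∀ a → F a ≐ G a) →
                 seq (map F as) ≐ seq (map G as)
  seq-map-cong []       F≐G = ≐-refl
  seq-map-cong (a ∷ as) F≐G = •-cong (F≐G a) (seq-map-cong as F≐G)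

  Functional : PartialOp → Set
  Functional f = ∀ {t u u′} → f t u → f t u′ → u ≡ u′

  Injective : PartialOp → Set
  Injective f = ∀ {t t′ u} → f t u → f t′ u → t ≡ t′

  seq-functional : ∀ {A : Set} {F : A → PartialOp} → (∀ a → Functional (F a)) →
                   ∀ as → Functional (seq (map F as))
  seq-functional F-fun []       refl refl = refl
  seq-functional F-fun (a ∷ as) (_ , fm , fs) (_ , fm′ , fs′) with F-fun a fm fm′
  ... | refl = seq-functional F-fun as fs fs′

  seq-injective : ∀ {A : Set} {F : A → PartialOp} → (∀ a → Injective (F a)) →
                  ∀ as → Injective (seq (map F as))
  seq-injective F-inj []       refl refl = refl
  seq-injective F-inj (a ∷ as) (_ , fm , fs) (_ , fm′ , fs′) with seq-injective F-inj as fs fs′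
  ... | refl = F-inj a fm fm′

  seq-last : ∀ {A : Set} (F : A → PartialOp) a as {t u} → seq (map F (a ∷ as)) t u →
             ∃ λ b → b ∈ a ∷ as × ∃ λ m → F b m u
  seq-last F a []       (_ , fa , refl) = a , here refl , _ , fa
  seq-last F a (b ∷ bs) (_ , _ , fs) with seq-last F b bs fs
  ... | c , c∈ , last = c , there c∈ , last

  Rule : Law → PartialOp
  Rule (l , r) t u = ∃ λ σ → t ≡ l ⟨ σ ⟩ × u ≡ r ⟨ σ ⟩

  Rule-functional : ∀ {l r} → Balanced (l , r) → Functional (Rule (l , r))
  Rule-functional bal (_ , refl , refl) (_ , e , refl) = rhs-determined bal e

  Rule-injective : ∀ {l r} → Balanced (l , r) → Injective (Rule (l , r))
  Rule-injective bal (_ , refl , refl) (_ , refl , e) = rhs-determined (Balanced-sym bal) e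

  at : Address → PartialOp → PartialOp
  at α f t u = ∃₂ λ s s′ → t / α ≡ just s × f s s′ × replace t α s′ ≡ just u

  O⁺-at : ∀ L α → O⁺ L α ≐ at α (Rule L)
  O⁺-at (l , r) α t u = mk⇔
    (λ (σ , e , r′) → _ , _ , e , (σ , refl , refl) , r′)
    (λ { (_ , _ , e , (σ , refl , refl) , r′) → σ , e , r′ })

  at-mono : ∀ α {f g} → f ⇒ g → at α f ⇒ at α g
  at-mono α f⇒g (s , s′ , e , fs , r) = s , s′ , e , f⇒g fs , r

  at-cong : ∀ α {f g} → f ≐ g → at α f ≐ at α g
  at-cong α f≐g t u = mk⇔ (at-mono α (to (f≐g _ _))) (at-mono α (from (f≐g _ _)))

  at-functional : ∀ α {f} → Functional f → Functional (at α f)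
  at-functional α f-fun (_ , _ , e , fs , r) (_ , _ , e′ , fs′ , r′) with trans (sym e) e′
  ... | refl with f-fun fs fs′
  ... | refl = just-injective (trans (sym r) r′)

  at-injective : ∀ α {f} → Injective f → Injective (at α f)
  at-injective α f-inj {t} {t′} (_ , _ , e , fs , r) (_ , _ , e′ , fs′ , r′)
    with trans (sym (/-replace t α r)) (/-replace t′ α r′)
  ... | refl with f-inj fs fs′
  ... | refl = just-injective (trans (sym (replace-undo t α e r)) (replace-undo t′ α e′ r′))

  at-++ : ∀ α β {f} → at (α ++ β) f ≐ at α (at β f)
  at-++ α β {f} _ _ = mk⇔ split join
    where
    split : at (α ++ β) f ⇒ at α (at β f)
    split {t} (s , s′ , e , fs , r) with t / α in eα | trans (sym (/-++ t α β)) e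
    ... | just m | eβ with replace m β s′ in rβ | trans (sym (replace-++ t α β s′ eα)) r
    ... | just m′ | rα = m , m′ , refl , (s , s′ , eβ , fs , rβ) , rα

    join : at α (at β f) ⇒ at (α ++ β) f
    join {t} (m , m′ , eα , (s , s′ , eβ , fs , rβ) , rα) =
      s , s′ , trans (/-++ t α β) (trans (cong (_>>= _/ β) eα) eβ) , fs ,
      trans (replace-++ t α β s′ eα) (trans (cong (_>>= λ n → replace t α n) rβ) rα)

  •-at : ∀ α {f g} → (at α f • at α g) ≐ at α (f • g)
  •-at α {f} {g} _ _ = mk⇔ fuse split
    where
    fuse : at α f • at α g ⇒ at α (f • g)
    fuse {t} (m , (s , s₁ , e , fs , r) , (_ , s₂ , e′ , gs , r′))
      with trans (sym (/-replace t α r)) e′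
    ... | refl = s , s₂ , e , (s₁ , fs , gs) , trans (sym (replace-replace t α s₂ r)) r′

    split : at α (f • g) ⇒ at α f • at α g
    split {t} (s , s₂ , e , (s₁ , fs , gs) , r) with replace-defined t α e s₁
    ... | m , rm =
      m , (s , s₁ , e , fs , rm) , (s₁ , s₂ , /-replace t α rm , gs , trans (replace-replace t α s₂ rm) r)

  seq-•-at : ∀ α {A : Set} (F : A → PartialOp) as g →
             (seq (map (λ a → at α (F a)) as) • at α g) ≐ at α (seq (map F as) • g)
  seq-•-at α F []       g = begin
    idOp • at α g       ≈⟨ •-identityˡ ⟩
    at α g              ≈⟨ at-cong α •-identityˡ ⟨
    at α (idOp • g)     ∎
  seq-•-at α F (a ∷ as) g = begin
    (at α (F a) • seq (map (λ a → at α (F a)) as)) • at α g  ≈⟨ •-assoc ⟩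
    at α (F a) • (seq (map (λ a → at α (F a)) as) • at α g)  ≈⟨ •-cong ≐-refl (seq-•-at α F as g) ⟩
    at α (F a) • at α (seq (map F as) • g)                    ≈⟨ •-at α ⟩
    at α (F a • (seq (map F as) • g))                         ≈⟨ at-cong α •-assoc ⟨
    at α ((F a • seq (map F as)) • g)                         ∎

  at-•-seq : ∀ α {A : Set} (F : A → PartialOp) as g →
             (at α g • seq (map (λ a → at α (F a)) as)) ≐ at α (g • seq (map F as))
  at-•-seq α F []       g = begin
    at α g • idOp       ≈⟨ •-identityʳ ⟩
    at α g              ≈⟨ at-cong α •-identityʳ ⟨
    at α (g • idOp)     ∎
  at-•-seq α F (a ∷ as) g = begin
    at α g • (at α (F a) • seq (map (λ a → at α (F a)) as))  ≈⟨ •-assoc ⟨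
    (at α g • at α (F a)) • seq (map (λ a → at α (F a)) as)  ≈⟨ •-cong (•-at α) ≐-refl ⟩
    at α (g • F a) • seq (map (λ a → at α (F a)) as)         ≈⟨ at-•-seq α F as (g • F a) ⟩
    at α ((g • F a) • seq (map F as))                         ≈⟨ at-cong α •-assoc ⟩
    at α (g • (F a • seq (map F as)))                         ∎

  seq-at-leaves : ∀ {R x} t ps {θ θ′} → Unique ps →
                  (∀ {p} → p ∈ ps → t / p ≡ just (var x) × R (θ p x) (θ′ p x)) →
                  (∀ ρ y → t / ρ ≡ just (var y) → ρ ∉ ps → θ ρ y ≡ θ′ ρ y) →
                  seq (map (λ p → at p R) ps) (t ⟪ θ ⟫) (t ⟪ θ′ ⟫)
  seq-at-leaves t [] _ _ agree = ⟪⟫-cong t (λ ρ y e → agree ρ y e λ ())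
  seq-at-leaves {R} {x} t (p ∷ ps) {θ} {θ′} (p∉ps ∷ unique) leaves agree =
    t ⟪ θ₁ ⟫ , step , seq-at-leaves t ps unique leaves₁ agree₁
    where
    θ₁ : PSubst
    θ₁ = θ [ p ≔ θ′ p ]

    step : at p R (t ⟪ θ ⟫) (t ⟪ θ₁ ⟫)
    step = let leaf , Rp = leaves (here refl) in
      θ p x , θ₁ p x , ⟪⟫-/ t θ leaf ,
      subst (λ τ → R (θ p x) (τ x)) (sym ([≔]-same θ p (θ′ p))) Rp ,
      replace-⟪⟫ t leaf (λ ρ y _ ρ≢p → sym (cong-app ([≔]-other θ (θ′ p) ρ≢p) y))

    leaves₁ : ∀ {q} → q ∈ ps → t / q ≡ just (var x) × R (θ₁ q x) (θ′ q x)
    leaves₁ {q} q∈ps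
      rewrite [≔]-other θ {a′ = q} (θ′ p) (λ q≡p → All.lookup p∉ps q∈ps (sym q≡p))
      = leaves (there q∈ps)

    agree₁ : ∀ ρ y → t / ρ ≡ just (var y) → ρ ∉ ps → θ₁ ρ y ≡ θ′ ρ y
    agree₁ ρ y e ρ∉ps with ρ ≟ₐ p
    ... | yes refl = refl
    ... | no  ρ≢p  = agree ρ y e λ { (here ρ≡p) → ρ≢p ρ≡p ; (there ρ∈ps) → ρ∉ps ρ∈ps }

  Occurrences : ℕ → Term → List Address → Set
  Occurrences x t ps = ∀ π → π ∈ ps ⇔ t / π ≡ just (var x)

  Occurrences-[] : ∀ {x t} → Occurrences x t [] → ¬ Occurs x t
  Occurrences-[] occ o with Occurs⇒leaf o
  ... | π , e with from (occ π) e
  ... | ()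

  record VarStep (R : PartialOp) (x : ℕ) (t : Term) (σ σ′ : Substitution) : Set where
    constructor varStep
    field
      on-x  : Occurs x t → R (σ x) (σ′ x)
      off-x : ∀ z → Occurs z t → z ≢ x → σ z ≡ σ′ z

  VarStep-⇔ : ∀ {R x t t′ σ σ′} → (∀ z → Occurs z t ⇔ Occurs z t′) →
              VarStep R x t σ σ′ → VarStep R x t′ σ σ′
  VarStep-⇔ {x = x} t⇔t′ (varStep on-x off-x) =
    varStep (on-x ∘ from (t⇔t′ x)) (λ z → off-x z ∘ from (t⇔t′ z))

  VarStep-absent : ∀ {R x t σ} → ¬ Occurs x t → VarStep R x t σ σ
  VarStep-absent x∉t = varStep (⊥-elim ∘ x∉t) (λ _ _ _ → refl)

  VarStep-↦ : ∀ {R x t} σ {v} → R (σ x) v → VarStep R x t σ (σ [ x ↦ v ])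
  VarStep-↦ {R} {x} σ {v} Rv = varStep
    (λ _ → subst (R (σ x)) (sym ([↦]-same σ x v)) Rv)
    (λ z _ z≢x → sym ([↦]-other σ v z≢x))

  ↦-VarStep : ∀ {R x t} σ′ {v} → R v (σ′ x) → VarStep R x t (σ′ [ x ↦ v ]) σ′
  ↦-VarStep {R} {x} σ′ {v} Rv = varStep
    (λ _ → subst (λ w → R w (σ′ x)) (sym ([↦]-same σ′ x v)) Rv)
    (λ z _ z≢x → [↦]-other σ′ v z≢x)

  seq-at-VarStep : ∀ {R x t ps σ σ′} → Unique ps → Occurrences x t ps → VarStep R x t σ σ′ →
                   seq (map (λ p → at p R) ps) (t ⟨ σ ⟩) (t ⟨ σ′ ⟩)
  seq-at-VarStep {R} {x} {t} {ps} {σ} {σ′} unique occ (varStep on-x off-x) =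
    subst₂ (seq (map (λ p → at p R) ps)) (⟪const⟫ t σ) (⟪const⟫ t σ′)
      (seq-at-leaves t ps unique leaves agree)
    where
    leaves : ∀ {p} → p ∈ ps → t / p ≡ just (var x) × R (σ x) (σ′ x)
    leaves {p} p∈ps = let e = to (occ p) p∈ps in e , on-x (leaf⇒Occurs t p e)

    agree : ∀ ρ y → t / ρ ≡ just (var y) → ρ ∉ ps → σ y ≡ σ′ y
    agree ρ y e ρ∉ps = off-x y (leaf⇒Occurs t ρ e) λ { refl → ρ∉ps (from (occ ρ) e) }

  -- The first step fixes the new value of x; seq-at-VarStep reaches the corresponding
  -- instance, and since all steps are functional nothing else is reached.
  seq-at-from-instance : ∀ {R x t ps σ u} → Functional R → Unique ps → Occurrences x t ps →
                         seq (map (λ p → at p R) ps) (t ⟨ σ ⟩) u →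
                         ∃ λ σ′ → u ≡ t ⟨ σ′ ⟩ × VarStep R x t σ σ′
  seq-at-from-instance {ps = []} {σ} _ _ occ refl = σ , refl , VarStep-absent (Occurrences-[] occ)
  seq-at-from-instance {R} {x} {t} {p ∷ ps} {σ} R-fun unique occ
                       steps@(_ , (s , s′ , e , Rss′ , _) , _)
    with trans (sym e) (⟨⟩-/ t σ {p} (to (occ p) (here refl)))
  ... | refl = σ [ x ↦ s′ ] ,
               seq-functional (λ p → at-functional p R-fun) (p ∷ ps) steps
                 (seq-at-VarStep unique occ step) ,
               step
    where
    step : VarStep R x t σ (σ [ x ↦ s′ ])
    step = VarStep-↦ σ Rss′

  -- Dually, the last step fixes the old value of x, and injectivity does the rest.
  seq-at-to-instance : ∀ {R x t ps σ′ u} → Injective R → Unique ps → Occurrences x t ps →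
                       seq (map (λ p → at p R) ps) u (t ⟨ σ′ ⟩) →
                       ∃ λ σ → u ≡ t ⟨ σ ⟩ × VarStep R x t σ σ′
  seq-at-to-instance {ps = []} {σ′} _ _ occ u≡t = σ′ , u≡t , VarStep-absent (Occurrences-[] occ)
  seq-at-to-instance {R} {x} {t} {p ∷ ps} {σ′} R-inj unique occ steps
    with seq-last (λ p → at p R) p ps steps
  ... | q , q∈ , m , (s , s′ , _ , Rss′ , r)
    with trans (sym (/-replace m q r)) (⟨⟩-/ t σ′ {q} (to (occ q) q∈))
  ... | refl = σ′ [ x ↦ s ] ,
               seq-injective (λ p → at-injective p R-inj) (p ∷ ps) steps
                 (seq-at-VarStep unique occ step) ,
               step
    where
    step : VarStep R x t (σ′ [ x ↦ s ]) σ′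
    step = ↦-VarStep σ′ Rss′

  occurrences-commute : ∀ {R l r x βs γs} → Functional R → Injective R → Balanced (l , r) →
                        Unique βs → Occurrences x l βs → Unique γs → Occurrences x r γs →
                        (seq (map (λ β → at β R) βs) • Rule (l , r))
                          ≐ (Rule (l , r) • seq (map (λ γ → at γ R) γs))
  occurrences-commute {R} {l} {r} {x} {βs} {γs} R-fun R-inj bal uβ occβ uγ occγ _ _ =
    mk⇔ forward backward
    where
    forward : seq (map (λ β → at β R) βs) • Rule (l , r)
            ⇒ Rule (l , r) • seq (map (λ γ → at γ R) γs)
    forward (_ , steps , σ′ , refl , refl) with seq-at-to-instance R-inj uβ occβ steps
    ... | σ , refl , step = r ⟨ σ ⟩ , (σ , refl , refl) , seq-at-VarStep uγ occγ (VarStep-⇔ bal step)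

    backward : Rule (l , r) • seq (map (λ γ → at γ R) γs)
             ⇒ seq (map (λ β → at β R) βs) • Rule (l , r)
    backward (_ , (σ , refl , refl) , steps) with seq-at-from-instance R-fun uγ occγ steps
    ... | σ′ , refl , step =
      l ⟨ σ′ ⟩ , seq-at-VarStep uβ occβ (VarStep-⇔ (Balanced-sym bal) step) , σ′ , refl , refl

proposition2p17 : (Op : Set) → let open Terms Op in
    (l r : Term) → Balanced (l , r) →
    (x : ℕ) → (βs γs : List Address) →
    Unique βs → (∀ β → β ∈ βs ⇔ l / β ≡ just (var x)) →
    Unique γs → (∀ γ → γ ∈ γs ⇔ r / γ ≡ just (var x)) →
    (L′ : Law) → Balanced L′ → (α δ : Address) →
    (seq (map (λ β → O⁺ L′ (α ++ β ++ δ)) βs) • O⁺ (l , r) α)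
      ≐ (O⁺ (l , r) α • seq (map (λ γ → O⁺ L′ (α ++ γ ++ δ)) γs))
proposition2p17 Op l r bal x βs γs uβ occβ uγ occγ (l′ , r′) bal′ α δ = begin
    seq (map (λ β → O⁺ (l′ , r′) (α ++ β ++ δ)) βs) • O⁺ (l , r) α
  ≈⟨ •-cong (seq-map-cong βs O⁺≐at-at) (O⁺-at (l , r) α) ⟩
    seq (map (λ β → at α (at β R)) βs) • at α (Rule (l , r))
  ≈⟨ seq-•-at α (λ β → at β R) βs (Rule (l , r)) ⟩
    at α (seq (map (λ β → at β R) βs) • Rule (l , r))
  ≈⟨ at-cong α (occurrences-commute R-functional R-injective bal uβ occβ uγ occγ) ⟩
    at α (Rule (l , r) • seq (map (λ γ → at γ R) γs))
  ≈⟨ at-•-seq α (λ γ → at γ R) γs (Rule (l , r)) ⟨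
    at α (Rule (l , r)) • seq (map (λ γ → at α (at γ R)) γs)
  ≈⟨ •-cong (O⁺-at (l , r) α) (seq-map-cong γs O⁺≐at-at) ⟨
    O⁺ (l , r) α • seq (map (λ γ → O⁺ (l′ , r′) (α ++ γ ++ δ)) γs)
  ∎
  where
  open Terms Op
  open Rewriting Op
  open SetoidReasoning ≐-setoid

  R : PartialOp
  R = at δ (Rule (l′ , r′))

  R-functional : Functional R
  R-functional = at-functional δ (Rule-functional bal′)

  R-injective : Injective R
  R-injective = at-injective δ (Rule-injective bal′)

  O⁺≐at-at : ∀ β → O⁺ (l′ , r′) (α ++ β ++ δ) ≐ at α (at β R)
  O⁺≐at-at β = begin
    O⁺ (l′ , r′) (α ++ β ++ δ)           ≈⟨ O⁺-at (l′ , r′) (α ++ β ++ δ) ⟩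
    at (α ++ β ++ δ) (Rule (l′ , r′))    ≈⟨ at-++ α (β ++ δ) ⟩
    at α (at (β ++ δ) (Rule (l′ , r′)))  ≈⟨ at-cong α (at-++ β δ) ⟩
    at α (at β R)                        ∎
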